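{- Let $t\ge1$ be a fixed constant integer and let $N$ and $R$ be integers. For any fixed $x\in\{0,1,\dots,N-1\}$, the number of tuples $(p^{(0)},p^{(1)},\dots,p^{(t-1)},h)$, where $p^{(0)},\dots,p^{(t-1)}$ are distinct primes in $[R/2,R]$ and $h$ is an integer with $1\le h<\prod_i p^{(i)}$ such that $h/\prod_i p^{(i)}\in[x/N,(x+1)/N)$, is $O(R^{t-1}+R^{2t}/N)$.
   Context: The constant in $O(\cdot)$ may depend on $t$. Tuples are ordered. -}

module Defs where

open import Data.Nat using (ℕ; zero; suc; _+_; _*_; _≤_; _<_; _≤?_; _<?_)
open import Data.Nat.Properties using (_≟_)
open import Data.Nat.Primality using (Prime; prime?)
open import Data.Nat.ListAction using (product)
open import Data.List using (List; []; _∷_; map; concatMap; upTo; length; filter)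
open import Data.List.Relation.Unary.All using (All; all?)
open import Data.List.Relation.Unary.Unique.Propositional using (Unique)
open import Data.List.Relation.Unary.Unique.DecPropositional _≟_ using (unique?)
open import Data.Vec using (Vec; toList) renaming ([] to []ᵥ; _∷_ to _∷ᵥ_)
open import Data.Product using (_×_; _,_)
open import Relation.Nullary using (Dec)
open import Relation.Nullary.Decidable using (_×-dec_)

allVecs : (t : ℕ) → List ℕ → List (Vec ℕ t)
allVecs zero    xs = []ᵥ ∷ []
allVecs (suc t) xs = concatMap (λ x → map (x ∷ᵥ_) (allVecs t xs)) xs

GoodPrime : ℕ → ℕ → Set
GoodPrime R p = Prime p × (R ≤ 2 * p) × (p ≤ R)

goodPrime? : (R p : ℕ) → Dec (GoodPrime R p)
goodPrime? R p = prime? p ×-dec ((R ≤? 2 * p) ×-dec (p ≤? R))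

-- The tuple (p⁽⁰⁾,…,p⁽ᵗ⁻¹⁾,h) is counted:
-- the p⁽ⁱ⁾ are distinct primes in [R/2,R], 1 ≤ h < P := ∏ p⁽ⁱ⁾,
-- and h/P ∈ [x/N, (x+1)/N), i.e. x·P ≤ h·N and h·N < (x+1)·P.
Valid : (t N R x : ℕ) → Vec ℕ t × ℕ → Set
Valid t N R x (ps , h) =
  All (GoodPrime R) (toList ps) × Unique (toList ps) ×
  (1 ≤ h) × (h < product (toList ps)) ×
  (x * product (toList ps) ≤ h * N) × (h * N < suc x * product (toList ps))

valid? : (t N R x : ℕ) → (c : Vec ℕ t × ℕ) → Dec (Valid t N R x c)
valid? t N R x (ps , h) =
  all? (goodPrime? R) (toList ps) ×-dec (unique? (toList ps) ×-dec
  ((1 ≤? h) ×-dec ((h <? product (toList ps)) ×-dec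
  ((x * product (toList ps) ≤? h * N) ×-dec (h * N <? suc x * product (toList ps))))))

-- Candidate tuples: entries of ps in {0,…,R}, h in {0,…,P-1}; each
-- candidate appears exactly once, and every valid tuple is a candidate.
candidates : (t R : ℕ) → List (Vec ℕ t × ℕ)
candidates t R =
  concatMap (λ ps → map (ps ,_) (upTo (product (toList ps)))) (allVecs t (upTo (suc R)))

count : (t N R x : ℕ) → ℕ
count t N R x = length (filter (valid? t N R x) (candidates t R))

-- A counted tuple (p⁽⁰⁾,…,p⁽ᵗ⁻¹⁾,h) has a prime q = p⁽ⁱ⁾ with q ∤ h, since 0 < h < P = ∏ p⁽ʲ⁾ and
-- the p⁽ʲ⁾ are distinct primes. Encode the tuple by i, the other t − 1 primes and u = ⌊hR²/q⌋.
-- Distinct fractions with denominators at most R are at least 1/R² apart, so u determines h/q,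
-- and as q ∤ h it determines q and h. Since h/P ∈ [x/N, (x+1)/N), h/q = (h/P)·M lies in
-- [xM/N, (x+1)M/N), where M = P/q ≤ Rᵗ⁻¹; so u − ⌊xR²M/N⌋ < 2 + Rᵗ⁺¹/N, and there are at most
-- t·(R+1)ᵗ⁻¹·(2 + Rᵗ⁺¹/N) codes.
module Submission where

open import Defs

open import Data.Nat using (ℕ; zero; suc; _+_; _*_; _∸_; _^_; _/_; _%_; _≤_; _<_; z≤n; s≤s;
  NonZero; >-nonZero; >-nonZero⁻¹; ≢-nonZero; nonTrivial⇒≢1)
open import Data.Nat.Properties
open import Data.Nat.DivMod using (m≡m%n+[m/n]*n; m%n<n; m/n*n≤m; m*n/n≡m; /-monoˡ-≤)
open import Data.Nat.Divisibility using (_∣_; _∣?_; ∣⇒≤; divides; ∣1⇒≡1; 1∣_; *-monoʳ-∣)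
open import Data.Nat.Coprimality using (Coprime; coprime-divisor)
import Data.Nat.Coprimality as Coprime
open import Data.Nat.Primality
  using (Prime; ¬prime[0]; prime⇒nonZero; prime⇒nonTrivial; prime⇒irreducible; euclidsLemma)
open import Data.Nat.ListAction using (product)
open import Data.Nat.ListAction.Properties using (product-↭)
open import Data.Nat.Tactic.RingSolver using (solve-∀)
open import Algebra.Properties.CommutativeSemigroup *-commutativeSemigroup using (xy∙z≈xz∙y; interchange)
open import Data.List using (List; []; _∷_; _++_; map; concatMap; cartesianProduct; length; filter; upTo; allFin)
open import Data.List.Properties using (length-++; length-map; length-upTo; length-tabulate; filter-none)
open import Data.List.Relation.Unary.All as All using (All; []; _∷_)
import Data.List.Relation.Unary.All.Properties as AllP
open import Data.List.Relation.Unary.Any as Any using (here; there)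
open import Data.List.Relation.Unary.AllPairs using ([]; _∷_)
open import Data.List.Relation.Unary.Unique.Propositional using (Unique)
import Data.List.Relation.Unary.Unique.Propositional.Properties as Unique
open import Data.List.Membership.Propositional using (_∈_)
open import Data.List.Membership.Propositional.Properties
  using (∈-++⁻; ∈-++⁺ˡ; ∈-++⁺ʳ; ∈-∃++; ∈-map⁺; ∈-map⁻; ∈-concatMap⁺; ∈-concatMap⁻;
         ∈-cartesianProduct⁺; ∈-allFin; ∈-upTo⁺; ∈-filter⁻)
open import Data.List.Relation.Binary.Subset.Propositional using (_⊆_)
open import Data.List.Relation.Binary.Permutation.Propositional using (_↭_; ↭-refl; ↭-prep; ↭-swap; ↭-trans)
open import Data.List.Relation.Binary.Permutation.Propositional.Properties using (All-resp-↭)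
open import Data.Vec using (Vec; toList; lookup; removeAt; insertAt; head; tail) renaming ([] to []ᵥ; _∷_ to _∷ᵥ_)
open import Data.Vec.Properties using (insertAt-removeAt)
import Data.Vec.Relation.Unary.All.Properties as AllV
open import Data.Fin using (Fin; zero; suc)
open import Data.Fin.Properties using (any?)
open import Data.Product using (_×_; _,_; proj₁; proj₂; ∃)
open import Data.Product.Properties using (,-injective)
open import Data.Sum using (inj₁; inj₂)
open import Function using (_∘_; id; case_of_)
open import Relation.Nullary using (¬_; contradiction; yes; no; ¬?)
open import Relation.Nullary.Decidable using (decidable-stable)
open import Relation.Binary.PropositionalEquality

private variable
  A B : Set

∈-++-∷⁻ : ∀ {w z : A} (ys zs : List A) → w ∈ ys ++ z ∷ zs → w ≢ z → w ∈ ys ++ zs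
∈-++-∷⁻ ys zs w∈ w≢z with ∈-++⁻ ys w∈
... | inj₁ p = ∈-++⁺ˡ p
... | inj₂ (here refl) = contradiction refl w≢z
... | inj₂ (there p) = ∈-++⁺ʳ ys p

Unique-⊆⇒length≤ : ∀ {xs ys : List A} → Unique xs → xs ⊆ ys → length xs ≤ length ys
Unique-⊆⇒length≤ {xs = []} _ _ = z≤n
Unique-⊆⇒length≤ {xs = x ∷ xs} (x∉xs ∷ uxs) xs⊆ys with ∈-∃++ (xs⊆ys (here refl))
... | ys₁ , ys₂ , refl = begin
  suc (length xs)                 ≤⟨ s≤s (Unique-⊆⇒length≤ uxs xs⊆ys₁ys₂) ⟩
  suc (length (ys₁ ++ ys₂))       ≡⟨ cong suc (length-++ ys₁) ⟩
  suc (length ys₁ + length ys₂)   ≡⟨ +-suc (length ys₁) _ ⟨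
  length ys₁ + length (x ∷ ys₂)   ≡⟨ length-++ ys₁ ⟨
  length (ys₁ ++ x ∷ ys₂)         ∎
  where
  open ≤-Reasoning
  xs⊆ys₁ys₂ : xs ⊆ ys₁ ++ ys₂
  xs⊆ys₁ys₂ w∈xs = ∈-++-∷⁻ ys₁ ys₂ (xs⊆ys (there w∈xs)) λ { refl → All.lookup x∉xs w∈xs refl }

Unique-map⁺-injectiveOn : ∀ (f : A → B) {xs : List A} → Unique xs →
  (∀ {x y} → x ∈ xs → y ∈ xs → f x ≡ f y → x ≡ y) → Unique (map f xs)
Unique-map⁺-injectiveOn f {xs = []} _ _ = []
Unique-map⁺-injectiveOn f {xs = x ∷ xs} (x∉xs ∷ uxs) f-inj =
  AllP.map⁺ (All.tabulate λ y∈xs fx≡fy → All.lookup x∉xs y∈xs (f-inj (here refl) (there y∈xs) fx≡fy))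
  ∷ Unique-map⁺-injectiveOn f uxs λ x∈ y∈ → f-inj (there x∈) (there y∈)

length≤-injectiveOn : ∀ (f : A → B) {xs : List A} {ys : List B} → Unique xs →
  (∀ {x y} → x ∈ xs → y ∈ xs → f x ≡ f y → x ≡ y) → (∀ {x} → x ∈ xs → f x ∈ ys) →
  length xs ≤ length ys
length≤-injectiveOn f {xs} {ys} uxs f-inj f-into = begin
  length xs         ≡⟨ length-map f xs ⟨
  length (map f xs) ≤⟨ Unique-⊆⇒length≤ (Unique-map⁺-injectiveOn f uxs f-inj) fxs⊆ys ⟩
  length ys         ∎
  where
  open ≤-Reasoning
  fxs⊆ys : map f xs ⊆ ys
  fxs⊆ys fx∈ with ∈-map⁻ f fx∈
  ... | _ , x∈xs , refl = f-into x∈xs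

Unique-concatMap⁺ : ∀ (f : A → List B) (key : B → A) {xs : List A} → Unique xs →
  (∀ x → Unique (f x)) → (∀ x {y} → y ∈ f x → key y ≡ x) → Unique (concatMap f xs)
Unique-concatMap⁺ f key {xs = []} _ _ _ = []
Unique-concatMap⁺ f key {xs = x ∷ xs} (x∉xs ∷ uxs) uf key-spec =
  Unique.++⁺ (uf x) (Unique-concatMap⁺ f key uxs uf key-spec) λ (y∈fx , y∈rest) →
    All.lookup x∉xs (Any.map (key-spec _) (∈-concatMap⁻ f y∈rest)) (sym (key-spec x y∈fx))

length-concatMap-const : ∀ (f : A → List B) {c : ℕ} (xs : List A) →
  (∀ x → length (f x) ≡ c) → length (concatMap f xs) ≡ length xs * c
length-concatMap-const f [] _ = refl
length-concatMap-const f (x ∷ xs) len-f =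
  trans (length-++ (f x)) (cong₂ _+_ (len-f x) (length-concatMap-const f xs len-f))

length-cartesianProduct : ∀ (xs : List A) (ys : List B) →
  length (cartesianProduct xs ys) ≡ length xs * length ys
length-cartesianProduct [] ys = refl
length-cartesianProduct (x ∷ xs) ys =
  trans (length-++ (map (x ,_) ys))
        (cong₂ _+_ (length-map (x ,_) ys) (length-cartesianProduct xs ys))

Unique-allVecs : ∀ t {xs : List ℕ} → Unique xs → Unique (allVecs t xs)
Unique-allVecs zero    _   = [] ∷ []
Unique-allVecs (suc t) uxs = Unique-concatMap⁺ _ head uxs
  (λ x → Unique.map⁺ (cong tail) (Unique-allVecs t uxs))
  (λ x v∈ → case ∈-map⁻ (x ∷ᵥ_) v∈ of λ { (_ , _ , refl) → refl })

length-allVecs : ∀ t (xs : List ℕ) → length (allVecs t xs) ≡ length xs ^ t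
length-allVecs zero    xs = refl
length-allVecs (suc t) xs = length-concatMap-const _ xs λ x →
  trans (length-map (x ∷ᵥ_) (allVecs t xs)) (length-allVecs t xs)

∈-allVecs⁺ : ∀ {t} {xs : List ℕ} (v : Vec ℕ t) → All (_∈ xs) (toList v) → v ∈ allVecs t xs
∈-allVecs⁺ []ᵥ      []            = here refl
∈-allVecs⁺ (y ∷ᵥ v) (y∈xs ∷ v⊆xs) =
  ∈-concatMap⁺ _ (Any.map (λ { refl → ∈-map⁺ (y ∷ᵥ_) (∈-allVecs⁺ v v⊆xs) }) y∈xs)

Unique-candidates : ∀ t R → Unique (candidates t R)
Unique-candidates t R = Unique-concatMap⁺ _ proj₁ (Unique-allVecs t (Unique.upTo⁺ (suc R)))
  (λ ps → Unique.map⁺ (cong proj₂) (Unique.upTo⁺ _))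
  (λ ps c∈ → case ∈-map⁻ (ps ,_) c∈ of λ { (_ , _ , refl) → refl })

toList-↭-lookup∷removeAt : ∀ {n} (xs : Vec A (suc n)) (i : Fin (suc n)) →
  toList xs ↭ lookup xs i ∷ toList (removeAt xs i)
toList-↭-lookup∷removeAt (x ∷ᵥ xs)          zero    = ↭-refl
toList-↭-lookup∷removeAt (x ∷ᵥ xs@(_ ∷ᵥ _)) (suc i) =
  ↭-trans (↭-prep x (toList-↭-lookup∷removeAt xs i)) (↭-swap x (lookup xs i) ↭-refl)

module _ {P : ℕ → Set} {n} (xs : Vec ℕ (suc n)) (i : Fin (suc n)) (pxs : All P (toList xs)) where

  All-lookup : P (lookup xs i)
  All-lookup = All.head (All-resp-↭ (toList-↭-lookup∷removeAt xs i) pxs)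

  All-removeAt : All P (toList (removeAt xs i))
  All-removeAt = All.tail (All-resp-↭ (toList-↭-lookup∷removeAt xs i) pxs)

product-removeAt : ∀ {n} (xs : Vec ℕ (suc n)) (i : Fin (suc n)) →
  product (toList xs) ≡ lookup xs i * product (toList (removeAt xs i))
product-removeAt xs i = product-↭ (toList-↭-lookup∷removeAt xs i)

product≤^ : ∀ {n} R (xs : Vec ℕ n) → All (_≤ R) (toList xs) → product (toList xs) ≤ R ^ n
product≤^ R []ᵥ       []           = ≤-refl
product≤^ R (x ∷ᵥ xs) (x≤R ∷ xs≤R) = *-mono-≤ x≤R (product≤^ R xs xs≤R)

prime≢1 : ∀ {p} → Prime p → p ≢ 1
prime≢1 p-prime = nonTrivial⇒≢1 {{prime⇒nonTrivial p-prime}}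

prime∣prime⇒≡ : ∀ {p q} → Prime p → Prime q → p ∣ q → p ≡ q
prime∣prime⇒≡ p-prime q-prime p∣q with prime⇒irreducible q-prime p∣q
... | inj₁ p≡1 = contradiction p≡1 (prime≢1 p-prime)
... | inj₂ p≡q = p≡q

prime∤⇒coprime : ∀ {p m} → Prime p → ¬ p ∣ m → Coprime p m
prime∤⇒coprime p-prime p∤m (d∣p , d∣m) with prime⇒irreducible p-prime d∣p
... | inj₁ d≡1  = d≡1
... | inj₂ refl = contradiction d∣m p∤m

prime∤product : ∀ {p} (qs : List ℕ) → Prime p → All Prime qs → All (p ≢_) qs → ¬ p ∣ product qs
prime∤product []       p-prime _ _ p∣1 = prime≢1 p-prime (∣1⇒≡1 p∣1)
prime∤product (q ∷ qs) p-prime (q-prime ∷ qs-prime) (p≢q ∷ p∉qs) p∣qQs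
  with euclidsLemma q (product qs) p-prime p∣qQs
... | inj₁ p∣q  = p≢q (prime∣prime⇒≡ p-prime q-prime p∣q)
... | inj₂ p∣Qs = prime∤product qs p-prime qs-prime p∉qs p∣Qs

distinctPrimes∣⇒product∣ : ∀ {m} (ps : List ℕ) → All Prime ps → Unique ps → All (_∣ m) ps →
  product ps ∣ m
distinctPrimes∣⇒product∣ []       _ _ _ = 1∣ _
distinctPrimes∣⇒product∣ {m} (p ∷ ps) (p-prime ∷ ps-prime) (p∉ps ∷ ups) (divides k m≡kp ∷ ps∣m) =
  subst (p * product ps ∣_) (sym m≡pk) (*-monoʳ-∣ p Qs∣k)
  where
  m≡pk : m ≡ p * k
  m≡pk = trans m≡kp (*-comm k p)
  Qs∣k : product ps ∣ k
  Qs∣k = coprime-divisor (Coprime.sym (prime∤⇒coprime p-prime (prime∤product ps p-prime ps-prime p∉ps)))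
           (subst (product ps ∣_) m≡pk (distinctPrimes∣⇒product∣ ps ps-prime ups ps∣m))

-- Division made total (m /₀ 0 = 0), so that the encoding below is defined on every candidate.
_/₀_ : ℕ → ℕ → ℕ
m /₀ zero  = 0
m /₀ suc n = m / suc n

/₀≡/ : ∀ m n .{{_ : NonZero n}} → m /₀ n ≡ m / n
/₀≡/ m (suc n) = refl

m<[1+m/n]*n : ∀ m n .{{_ : NonZero n}} → m < suc (m / n) * n
m<[1+m/n]*n m n = begin-strict
  m                 ≡⟨ m≡m%n+[m/n]*n m n ⟩
  m % n + m / n * n <⟨ +-monoˡ-< (m / n * n) (m%n<n m n) ⟩
  n + m / n * n     ∎
  where open ≤-Reasoning

m*n≤o⇒m≤o/n : ∀ m n o .{{_ : NonZero n}} → m * n ≤ o → m ≤ o / n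
m*n≤o⇒m≤o/n m n o mn≤o = subst (_≤ o / n) (m*n/n≡m m n) (/-monoˡ-≤ n mn≤o)

m*o≤n*p⇒m/p≤n/o : ∀ m n o p .{{_ : NonZero o}} .{{_ : NonZero p}} → m * o ≤ n * p → m / p ≤ n / o
m*o≤n*p⇒m/p≤n/o m n o p mo≤np = m*n≤o⇒m≤o/n (m / p) o n (*-cancelʳ-≤ (m / p * o) n p (begin
  m / p * o * p ≡⟨ xy∙z≈xz∙y (m / p) o p ⟩
  m / p * p * o ≤⟨ *-monoˡ-≤ o (m/n*n≤m m p) ⟩
  m * o         ≤⟨ mo≤np ⟩
  n * p         ∎))
  where open ≤-Reasoning

[n/o∸m/p]*p<p+k : ∀ m n o p k .{{_ : NonZero o}} .{{_ : NonZero p}} → n * p < (k + m) * o →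
  (n / o ∸ m / p) * p < p + k
[n/o∸m/p]*p<p+k m n o p k np<[k+m]o = begin-strict
  (n / o ∸ m / p) * p   ≡⟨ *-distribʳ-∸ p (n / o) (m / p) ⟩
  n / o * p ∸ m / p * p <⟨ m<n+o⇒m∸n<o (n / o * p) (m / p * p) {{p+k≢0}} [n/o]p<[m/p]p+p+k ⟩
  p + k                 ∎
  where
  open ≤-Reasoning
  p+k≢0 : NonZero (p + k)
  p+k≢0 = >-nonZero (<-≤-trans (>-nonZero⁻¹ p) (m≤m+n p k))
  [n/o]p<k+m : n / o * p < k + m
  [n/o]p<k+m = *-cancelʳ-< o (n / o * p) (k + m) (begin-strict
    n / o * p * o ≡⟨ xy∙z≈xz∙y (n / o) p o ⟩
    n / o * o * p ≤⟨ *-monoˡ-≤ p (m/n*n≤m n o) ⟩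
    n * p         <⟨ np<[k+m]o ⟩
    (k + m) * o   ∎)
  [n/o]p<[m/p]p+p+k : n / o * p < m / p * p + (p + k)
  [n/o]p<[m/p]p+p+k = begin-strict
    n / o * p           <⟨ [n/o]p<k+m ⟩
    k + m               <⟨ +-monoʳ-< k (m<[1+m/n]*n m p) ⟩
    k + (p + m / p * p) ≡⟨ +-comm k _ ⟩
    p + m / p * p + k   ≡⟨ cong (_+ k) (+-comm p _) ⟩
    m / p * p + p + k   ≡⟨ +-assoc (m / p * p) p k ⟩
    m / p * p + (p + k) ∎

window-fractions-≮ : ∀ {L q q′ h h′ u} → q * q′ ≤ L → u * q ≤ h * L → h′ * L < suc u * q′ → ¬ h * q′ < h′ * q
window-fractions-≮ {L} {q} {q′} {h} {h′} {u} qq′≤L uq≤hL h′L<[1+u]q′ hq′<h′q = <-irrefl refl (begin-strict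
  L + h * q′ * L        ≤⟨ *-monoˡ-≤ L hq′<h′q ⟩
  h′ * q * L            ≡⟨ xy∙z≈xz∙y h′ q L ⟩
  h′ * L * q            <⟨ *-monoˡ-< q {{q≢0}} h′L<[1+u]q′ ⟩
  (q′ + u * q′) * q     ≡⟨ *-distribʳ-+ q q′ (u * q′) ⟩
  q′ * q + u * q′ * q   ≡⟨ cong₂ _+_ (*-comm q′ q) (xy∙z≈xz∙y u q′ q) ⟩
  q * q′ + u * q * q′   ≤⟨ +-mono-≤ qq′≤L (*-monoˡ-≤ q′ uq≤hL) ⟩
  L + h * L * q′        ≡⟨ cong (L +_) (xy∙z≈xz∙y h L q′) ⟩
  L + h * q′ * L        ∎)
  where
  open ≤-Reasoning
  q≢0 : NonZero q
  q≢0 = ≢-nonZero λ { refl → n≮0 (subst (h * q′ <_) (*-zeroʳ h′) hq′<h′q) }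

-- h/q and h′/q′ both lie in [u/L, (u+1)/L), so they differ by less than 1/L ≤ 1/(qq′).
window-fractions-≡ : ∀ {L q q′ h h′ u} → q * q′ ≤ L → u * q ≤ h * L → h * L < suc u * q →
  u * q′ ≤ h′ * L → h′ * L < suc u * q′ → h * q′ ≡ h′ * q
window-fractions-≡ {L} {q} {q′} {h} {h′} {u} qq′≤L uq≤hL hL<[1+u]q uq′≤h′L h′L<[1+u]q′ = ≤-antisym
  (≮⇒≥ (window-fractions-≮ {L} {q′} {q} {h′} {h} {u} (subst (_≤ L) (*-comm q q′) qq′≤L) uq′≤h′L hL<[1+u]q))
  (≮⇒≥ (window-fractions-≮ {L} {q} {q′} {h} {h′} {u} qq′≤L uq≤hL h′L<[1+u]q′))

prime-fraction-unique : ∀ {q q′ h h′} → Prime q → Prime q′ → ¬ q ∣ h → h * q′ ≡ h′ * q →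
  q ≡ q′ × h ≡ h′
prime-fraction-unique {q} {q′} {h} {h′} q-prime q′-prime q∤h hq′≡h′q
  with euclidsLemma h q′ q-prime (divides h′ hq′≡h′q)
... | inj₁ q∣h  = contradiction q∣h q∤h
... | inj₂ q∣q′ with prime∣prime⇒≡ q-prime q′-prime q∣q′
...   | refl = refl , *-cancelʳ-≡ h h′ q {{prime⇒nonZero q-prime}} hq′≡h′q

nonDivisor : ∀ {n} → Vec ℕ (suc n) → ℕ → Fin (suc n)
nonDivisor ps h with any? (λ i → ¬? (lookup ps i ∣? h))
... | yes (i , _) = i
... | no  _       = zero

nonDivisor-∤ : ∀ {n} (ps : Vec ℕ (suc n)) h → ¬ (∀ i → lookup ps i ∣ h) →
  ¬ lookup ps (nonDivisor ps h) ∣ h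
nonDivisor-∤ ps h ¬all∣ with any? (λ i → ¬? (lookup ps i ∣? h))
... | yes (_ , ∤h) = ∤h
... | no  ¬any∤    = contradiction (λ i → decidable-stable (lookup ps i ∣? h) λ ∤h → ¬any∤ (i , ∤h)) ¬all∣

[1+m]^n≤2^n*m^n : ∀ {m} n → 1 ≤ m → suc m ^ n ≤ 2 ^ n * m ^ n
[1+m]^n≤2^n*m^n     zero    _   = ≤-refl
[1+m]^n≤2^n*m^n {m} (suc n) 1≤m = begin
  suc m * suc m ^ n       ≤⟨ *-mono-≤ 1+m≤2m ([1+m]^n≤2^n*m^n n 1≤m) ⟩
  2 * m * (2 ^ n * m ^ n) ≡⟨ interchange 2 m (2 ^ n) (m ^ n) ⟩
  2 * 2 ^ n * (m * m ^ n) ∎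
  where
  open ≤-Reasoning
  1+m≤2m : suc m ≤ 2 * m
  1+m≤2m = subst (_≤ 2 * m) (cong suc (+-identityʳ m)) (+-monoˡ-≤ (m + 0) 1≤m)

R^[2*[1+n]]≡R^n*[R*R*R^n] : ∀ R n → R ^ (2 * suc n) ≡ R ^ n * (R * R * R ^ n)
R^[2*[1+n]]≡R^n*[R*R*R^n] R n = begin
  R ^ (2 * suc n)           ≡⟨ cong (R ^_) (exponent n) ⟩
  R ^ (n + (2 + n))         ≡⟨ ^-distribˡ-+-* R n (2 + n) ⟩
  R ^ n * (R * (R * R ^ n)) ≡⟨ cong (R ^ n *_) (*-assoc R R (R ^ n)) ⟨
  R ^ n * (R * R * R ^ n)   ∎
  where
  open ≡-Reasoning
  exponent : ∀ n → 2 * suc n ≡ n + (2 + n)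
  exponent = solve-∀

count≡0-when-R≡0 : ∀ n N x → count (suc n) N 0 x ≡ 0
count≡0-when-R≡0 n N x = cong length (filter-none (valid? (suc n) N 0 x)
  (All.universal (λ { (_ ∷ᵥ _ , _) ((p-prime , _ , z≤n) ∷ _ , _) → ¬prime[0] p-prime }) (candidates (suc n) 0)))

module Encoding (n N R x : ℕ) .{{_ : NonZero N}} where

  L : ℕ
  L = R * R

  gridPoint : Vec ℕ (suc n) → ℕ → Fin (suc n) → ℕ
  gridPoint ps h i = (h * L) /₀ lookup ps i

  gridBase : Vec ℕ n → ℕ
  gridBase vs = (x * (L * product (toList vs))) / N

  encode : Vec ℕ (suc n) × ℕ → Fin (suc n) × Vec ℕ n × ℕ
  encode (ps , h) = i , removeAt ps i , gridPoint ps h i ∸ gridBase (removeAt ps i)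
    where i = nonDivisor ps h

  Valid′ : Vec ℕ (suc n) × ℕ → Set
  Valid′ = Valid (suc n) N R x

  valid⇒¬all∣ : ∀ {ps h} → Valid′ (ps , h) → ¬ (∀ i → lookup ps i ∣ h)
  valid⇒¬all∣ {ps} (good , distinct , 1≤h , h<P , _) all∣ =
    <⇒≱ h<P (∣⇒≤ {{>-nonZero 1≤h}} (distinctPrimes∣⇒product∣ (toList ps) (All.map proj₁ good) distinct
      (AllV.toList⁺ (AllV.lookup⁻ all∣))))

  module _ {ps : Vec ℕ (suc n)} {h : ℕ} (i : Fin (suc n)) (valid : Valid′ (ps , h)) where

    private
      q = lookup ps i
      M = product (toList (removeAt ps i))
      P = product (toList ps)
      q-good : GoodPrime R q
      q-good = All-lookup ps i (proj₁ valid)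
      h/P-window : x * P ≤ h * N × h * N < suc x * P
      h/P-window = proj₂ (proj₂ (proj₂ (proj₂ valid)))
      instance
        q≢0 : NonZero q
        q≢0 = prime⇒nonZero (proj₁ q-good)
        L≢0 : NonZero L
        L≢0 = >-nonZero (*-mono-< R>0 R>0)
          where R>0 = <-≤-trans (>-nonZero⁻¹ q) (proj₂ (proj₂ q-good))
      gridPoint≡ : gridPoint ps h i ≡ h * L / q
      gridPoint≡ = /₀≡/ (h * L) q
      rescale : ∀ y → y * P * L ≡ y * (L * M) * q
      rescale y = begin
        y * P * L           ≡⟨ cong (λ P → y * P * L) (product-removeAt ps i) ⟩
        y * (q * M) * L     ≡⟨ rearrange y q M L ⟩
        y * (L * M) * q     ∎
        where
        open ≡-Reasoning
        rearrange : ∀ y q M L → y * (q * M) * L ≡ y * (L * M) * q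
        rearrange = solve-∀
      hL/q-lower : x * (L * M) * q ≤ h * L * N
      hL/q-lower = begin
        x * (L * M) * q ≡⟨ rescale x ⟨
        x * P * L       ≤⟨ *-monoˡ-≤ L (proj₁ h/P-window) ⟩
        h * N * L       ≡⟨ xy∙z≈xz∙y h N L ⟩
        h * L * N       ∎
        where open ≤-Reasoning
      hL/q-upper : h * L * N < suc x * (L * M) * q
      hL/q-upper = begin-strict
        h * L * N             ≡⟨ xy∙z≈xz∙y h L N ⟩
        h * N * L             <⟨ *-monoˡ-< L (proj₂ h/P-window) ⟩
        suc x * P * L         ≡⟨ rescale (suc x) ⟩
        suc x * (L * M) * q   ∎
        where open ≤-Reasoning

    gridPoint-bounds : gridPoint ps h i * lookup ps i ≤ h * L × h * L < suc (gridPoint ps h i) * lookup ps i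
    gridPoint-bounds rewrite gridPoint≡ = m/n*n≤m (h * L) q , m<[1+m/n]*n (h * L) q

    gridBase≤gridPoint : gridBase (removeAt ps i) ≤ gridPoint ps h i
    gridBase≤gridPoint rewrite gridPoint≡ = m*o≤n*p⇒m/p≤n/o (x * (L * M)) (h * L) q N hL/q-lower

    offset-bound : (gridPoint ps h i ∸ gridBase (removeAt ps i)) * N < N + L * product (toList (removeAt ps i))
    offset-bound rewrite gridPoint≡ = [n/o∸m/p]*p<p+k (x * (L * M)) (h * L) q N (L * M) hL/q-upper

  gridPoint-injective : ∀ {ps ps′ h h′} i → Valid′ (ps , h) → Valid′ (ps′ , h′) → ¬ lookup ps i ∣ h →
    removeAt ps i ≡ removeAt ps′ i → gridPoint ps h i ≡ gridPoint ps′ h′ i → (ps , h) ≡ (ps′ , h′)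
  gridPoint-injective {ps} {ps′} {h} {h′} i valid valid′ q∤h vs≡vs′ u≡u′
    with prime-fraction-unique {h = h} {h′} (proj₁ q-good) (proj₁ q′-good) q∤h hq′≡h′q
    where
    q-good  = All-lookup ps i (proj₁ valid)
    q′-good = All-lookup ps′ i (proj₁ valid′)
    u′-bounds = gridPoint-bounds i valid′
    hq′≡h′q : h * lookup ps′ i ≡ h′ * lookup ps i
    hq′≡h′q = window-fractions-≡ {L} {lookup ps i} {lookup ps′ i} {h} {h′} {gridPoint ps h i}
      (*-mono-≤ (proj₂ (proj₂ q-good)) (proj₂ (proj₂ q′-good)))
      (proj₁ (gridPoint-bounds i valid)) (proj₂ (gridPoint-bounds i valid))
      (subst (λ u → u * _ ≤ _) (sym u≡u′) (proj₁ u′-bounds))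
      (subst (λ u → _ < suc u * _) (sym u≡u′) (proj₂ u′-bounds))
  ... | q≡q′ , refl = cong (_, h) (begin
    ps                                         ≡⟨ insertAt-removeAt ps i ⟨
    insertAt (removeAt ps i) i (lookup ps i)   ≡⟨ cong₂ (λ vs q → insertAt vs i q) vs≡vs′ q≡q′ ⟩
    insertAt (removeAt ps′ i) i (lookup ps′ i) ≡⟨ insertAt-removeAt ps′ i ⟩
    ps′                                        ∎)
    where open ≡-Reasoning

  encode-injective : ∀ {c c′} → Valid′ c → Valid′ c′ → encode c ≡ encode c′ → c ≡ c′
  encode-injective {ps , h} {ps′ , h′} valid valid′ =
    go (nonDivisor-∤ ps h (valid⇒¬all∣ valid))
    where
    go : ∀ {i i′} → ¬ lookup ps i ∣ h →
      (i , removeAt ps i , gridPoint ps h i ∸ gridBase (removeAt ps i)) ≡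
      (i′ , removeAt ps′ i′ , gridPoint ps′ h′ i′ ∸ gridBase (removeAt ps′ i′)) →
      (ps , h) ≡ (ps′ , h′)
    go {i} q∤h eq with ,-injective eq
    ... | refl , eq′ with ,-injective eq′
    ...   | vs≡vs′ , offset≡offset′ = gridPoint-injective i valid valid′ q∤h vs≡vs′
            (∸-cancelʳ-≡ (gridBase≤gridPoint i valid) base≤u′
              (trans offset≡offset′ (cong (λ vs → gridPoint ps′ h′ i ∸ gridBase vs) (sym vs≡vs′))))
      where
      base≤u′ : gridBase (removeAt ps i) ≤ gridPoint ps′ h′ i
      base≤u′ = subst (λ vs → gridBase vs ≤ _) (sym vs≡vs′) (gridBase≤gridPoint i valid′)

  offsetBound : ℕ
  offsetBound = 2 + L * R ^ n / N

  offset<offsetBound : ∀ {ps h} i → Valid′ (ps , h) →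
    gridPoint ps h i ∸ gridBase (removeAt ps i) < offsetBound
  offset<offsetBound {ps} {h} i valid@(good , _) = *-cancelʳ-< N _ offsetBound (begin-strict
    (gridPoint ps h i ∸ gridBase (removeAt ps i)) * N <⟨ offset-bound i valid ⟩
    N + L * product (toList (removeAt ps i))           ≤⟨ +-monoʳ-≤ N (*-monoʳ-≤ L M≤Rⁿ) ⟩
    N + L * R ^ n                                      <⟨ +-monoʳ-< N (m<[1+m/n]*n (L * R ^ n) N) ⟩
    offsetBound * N                                    ∎)
    where
    open ≤-Reasoning
    M≤Rⁿ : product (toList (removeAt ps i)) ≤ R ^ n
    M≤Rⁿ = product≤^ R (removeAt ps i) (All-removeAt ps i (All.map (proj₂ ∘ proj₂) good))

  offsetBound*N≤ : offsetBound * N ≤ N + (N + L * R ^ n)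
  offsetBound*N≤ = +-monoʳ-≤ N (+-monoʳ-≤ N (m/n*n≤m (L * R ^ n) N))

  boundedVecs : List (Vec ℕ n)
  boundedVecs = allVecs n (upTo (suc R))

  codes : List (Fin (suc n) × Vec ℕ n × ℕ)
  codes = cartesianProduct (allFin (suc n)) (cartesianProduct boundedVecs (upTo offsetBound))

  length-codes : length codes ≡ suc n * (suc R ^ n * offsetBound)
  length-codes = begin
    length codes
      ≡⟨ length-cartesianProduct (allFin (suc n)) (cartesianProduct boundedVecs (upTo offsetBound)) ⟩
    length (allFin (suc n)) * length (cartesianProduct boundedVecs (upTo offsetBound))
      ≡⟨ cong₂ _*_ (length-tabulate {n = suc n} id) (length-cartesianProduct boundedVecs (upTo offsetBound)) ⟩
    suc n * (length boundedVecs * length (upTo offsetBound))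
      ≡⟨ cong₂ (λ a b → suc n * (a * b)) length-boundedVecs (length-upTo offsetBound) ⟩
    suc n * (suc R ^ n * offsetBound)
      ∎
    where
    open ≡-Reasoning
    length-boundedVecs : length boundedVecs ≡ suc R ^ n
    length-boundedVecs = trans (length-allVecs n (upTo (suc R))) (cong (_^ n) (length-upTo (suc R)))

  encode-∈-codes : ∀ {c} → Valid′ c → encode c ∈ codes
  encode-∈-codes {ps , h} valid@(good , _) =
    ∈-cartesianProduct⁺ (∈-allFin i) (∈-cartesianProduct⁺
      (∈-allVecs⁺ (removeAt ps i) (All-removeAt ps i (All.map (λ (_ , _ , p≤R) → ∈-upTo⁺ (s≤s p≤R)) good)))
      (∈-upTo⁺ (offset<offsetBound i valid)))
    where i = nonDivisor ps h

  count≤ : count (suc n) N R x ≤ suc n * (suc R ^ n * offsetBound)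
  count≤ = begin
    count (suc n) N R x               ≤⟨ length≤-injectiveOn encode (Unique.filter⁺ valid?′ (Unique-candidates (suc n) R))
                                           (λ c∈ c′∈ → encode-injective (validOf c∈) (validOf c′∈))
                                           (encode-∈-codes ∘ validOf) ⟩
    length codes                      ≡⟨ length-codes ⟩
    suc n * (suc R ^ n * offsetBound) ∎
    where
    open ≤-Reasoning
    valid?′ = valid? (suc n) N R x
    validOf : ∀ {c} → c ∈ filter valid?′ (candidates (suc n) R) → Valid′ c
    validOf = proj₂ ∘ ∈-filter⁻ valid?′ {xs = candidates (suc n) R}

  count*N≤ : 1 ≤ R → count (suc n) N R x * N ≤ 2 * suc n * 2 ^ n * (R ^ n * N + R ^ (2 * suc n))
  count*N≤ 1≤R = begin
    count t N R x * N
      ≤⟨ *-monoˡ-≤ N count≤ ⟩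
    t * (suc R ^ n * offsetBound) * N
      ≡⟨ regroup t (suc R ^ n) offsetBound N ⟩
    t * suc R ^ n * (offsetBound * N)
      ≤⟨ *-mono-≤ (*-monoʳ-≤ t ([1+m]^n≤2^n*m^n n 1≤R)) offsetBound*N≤ ⟩
    t * (2 ^ n * Rⁿ) * (N + (N + L * Rⁿ))
      ≤⟨ m≤m+n _ (t * (2 ^ n * Rⁿ) * (L * Rⁿ)) ⟩
    t * (2 ^ n * Rⁿ) * (N + (N + L * Rⁿ)) + t * (2 ^ n * Rⁿ) * (L * Rⁿ)
      ≡⟨ expand t (2 ^ n) Rⁿ N L ⟩
    2 * t * 2 ^ n * (Rⁿ * N + Rⁿ * (L * Rⁿ))
      ≡⟨ cong (λ m → 2 * t * 2 ^ n * (Rⁿ * N + m)) (R^[2*[1+n]]≡R^n*[R*R*R^n] R n) ⟨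
    2 * t * 2 ^ n * (Rⁿ * N + R ^ (2 * t))
      ∎
    where
    open ≤-Reasoning
    t = suc n
    Rⁿ = R ^ n
    regroup : ∀ a b c d → a * (b * c) * d ≡ a * b * (c * d)
    regroup = solve-∀
    expand : ∀ a b c d e → a * (b * c) * (d + (d + e * c)) + a * (b * c) * (e * c) ≡ 2 * a * b * (c * d + c * (e * c))
    expand = solve-∀

lemma6p3 : (t : ℕ) → 1 ≤ t →
    ∃ λ (C : ℕ) → ∀ (N R x : ℕ) → x < N →
      count t N R x * N ≤ C * (R ^ (t ∸ 1) * N + R ^ (2 * t))
lemma6p3 (suc n) _ = 2 * suc n * 2 ^ n , bound
  where
  bound : ∀ N R x → x < N → count (suc n) N R x * N ≤ 2 * suc n * 2 ^ n * (R ^ n * N + R ^ (2 * suc n))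
  bound (suc _)   zero      x _ = subst (λ c → c * _ ≤ _) (sym (count≡0-when-R≡0 n _ x)) z≤n
  bound N@(suc _) R@(suc _) x _ = Encoding.count*N≤ n N R x (s≤s z≤n)
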